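{- Let $\mathcal{A}$ be a finite alphabet and let $s$ be a balanced standard episturmian sequence over $\mathcal{A}$ containing at least three distinct letters. Suppose a directive sequence of $s$ is $\Delta(s)=a\,y\,a\,z$ with $a\in\mathcal{A}$, $y\in\mathcal{A}^+$ nonempty with pairwise distinct letters, $z\in\mathcal{A}^{\omega}$, and $|y|_a=|z|_a=0$. Then there exist $r\ge0$ and letters $b_1,\dots,b_r,c$ such that $a$, the letters of $y$, $b_1,\dots,b_r$ and $c$ are pairwise distinct and $\Delta(s)=a\,y\,a\,b_1\cdots b_r\,c^{\omega}$ (i.e. up to renaming, $\Delta(s)=123\cdots k\,1\,(k+1)\cdots(k+\ell)(k+\ell+1)^{\omega}$).
   Context: For a finite word $w$, $w^{(+)}$ denotes the shortest palindrome having $w$ as a prefix. For an infinite word $\Delta=x_1x_2\cdots$ set $u_1=\varepsilon$, $u_{n+1}=(u_nx_n)^{(+)}$. An infinite word $s$ is standard episturmian if there exists an infinite word $\Delta$ (a directive sequence of $s$) such that every $u_n$ is a prefix of $s$. A word is balanced if for any two factors $u,v$ of the same length and every letter $e$, $||u|_e-|v|_e|\le1$, where $|u|_e$ counts occurrences of $e$ in $u$. -}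

module Defs where

open import Data.Nat using (ℕ; zero; suc; _+_; _≤_; _<_; ∣_-_∣)
open import Data.Fin using (Fin; _≟_)
open import Data.List using (List; []; _∷_; _++_; [_]; length; reverse; filter; lookup)
open import Data.List.Relation.Unary.Unique.Propositional using (Unique)
open import Data.List.Membership.Propositional using (_∈_)
open import Data.Product using (Σ; ∃; _×_; _,_)
open import Relation.Binary.PropositionalEquality using (_≡_; _≢_)

InfWord : ℕ → Set
InfWord k = ℕ → Fin k

factor : ∀ {k} → InfWord k → ℕ → ℕ → List (Fin k)
factor s i zero    = []
factor s i (suc n) = s i ∷ factor s (suc i) n

occ : ∀ {k} → Fin k → List (Fin k) → ℕ
occ e w = length (filter (e ≟_) w)

IsPrefix : ∀ {k} → List (Fin k) → List (Fin k) → Set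
IsPrefix w p = ∃ λ v → w ++ v ≡ p

IsPrefixOf : ∀ {k} → List (Fin k) → InfWord k → Set
IsPrefixOf w s = factor s 0 (length w) ≡ w

IsPalindrome : ∀ {k} → List (Fin k) → Set
IsPalindrome w = reverse w ≡ w

IsPalClosure : ∀ {k} → List (Fin k) → List (Fin k) → Set
IsPalClosure w p =
  IsPalindrome p × IsPrefix w p ×
  (∀ q → IsPalindrome q → IsPrefix w q → length p ≤ length q)

-- Δ is a directive sequence of s: the sequence u_1 = ε, u_{n+1} = (u_n x_n)^(+)
-- (here indexed from 0: u 0 = ε, u (n+1) = (u n · Δ n)^(+)) consists of prefixes of s.
IsDirective : ∀ {k} → InfWord k → InfWord k → Set
IsDirective {k} Δ s =
  Σ (ℕ → List (Fin k)) λ u →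
    (u 0 ≡ []) ×
    (∀ n → IsPalClosure (u n ++ [ Δ n ]) (u (suc n))) ×
    (∀ n → IsPrefixOf (u n) s)

StandardEpisturmian : ∀ {k} → InfWord k → Set
StandardEpisturmian s = ∃ λ Δ → IsDirective Δ s

Balanced : ∀ {k} → InfWord k → Set
Balanced s = ∀ i j n e → ∣ occ e (factor s i n) - occ e (factor s j n) ∣ ≤ 1

AtLeastThreeLetters : ∀ {k} → InfWord k → Set
AtLeastThreeLetters s =
  ∃ λ i → ∃ λ j → ∃ λ l → (s i ≢ s j) × (s i ≢ s l) × (s j ≢ s l)

{-# OPTIONS --safe #-}
-- Call position n of Δ fresh when the letter Δ n does not occur earlier in Δ. For fresh n the
-- palindromic prefixes satisfy u (n+1) = u n · Δ n · u n, and a later occurrence of Δ n gives the factor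
-- Δ n · u n · Δ n. If some position p > n is fresh too, then u n (a suffix of u p), followed by Δ p and
-- by the first letter of s, is a factor of the same length avoiding Δ n, which balance forbids. So a
-- fresh letter never recurs once a further fresh letter has appeared; for y₁ that further letter exists
-- because s has a third letter. The last letter of y = y₁ ⋯ y_m is followed by a rather than by a fresh
-- letter; there u (m+2) = u (m+1) · u (m+1) supplies the factor avoiding it instead. Hence no letter of
-- a y occurs in z, the letters of z are fresh up to a first repetition, which must be z (r+1) = z r,
-- and after it neither a fresh letter nor an earlier letter other than z r can appear.
module Submission where

open import Defs
open import Function using (_∘_)
open import Data.Nat using (ℕ; zero; suc; _+_; _∸_; _<_; _≤_; z≤n; s≤s; z<s; s<s; ∣_-_∣)
open import Data.Nat.Properties hiding (_≟_)
open import Data.Nat.Induction using (<-rec)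
open import Data.Fin using (Fin; _≟_; toℕ; fromℕ<)
open import Data.Fin.Properties using (toℕ<n; toℕ-fromℕ<; pigeonhole)
open import Data.List using (List; []; _∷_; _++_; [_]; length; lookup; reverse; applyUpTo; applyDownFrom)
open import Data.List.Properties
  using ( ∷-injective; ++-assoc; length-++; reverse-++; reverse-applyUpTo; applyUpTo-∷ʳ; lookup-applyUpTo
        ; length-applyUpTo; filter-accept; filter-reject)
open import Data.List.Relation.Unary.AllPairs using (_∷_)
open import Data.List.Relation.Unary.Unique.Propositional using (Unique)
open import Data.List.Relation.Unary.Unique.Propositional.Properties using (++⁺; applyUpTo⁺₁)
open import Data.List.Membership.Propositional using (_∈_)
open import Data.List.Membership.Propositional.Properties using (∈-applyUpTo⁻)
open import Data.List.Relation.Unary.All.Properties as All using (¬Any⇒All¬)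
open import Data.Product using (Σ; ∃; _×_; _,_; proj₁; proj₂)
open import Data.Sum using (_⊎_; inj₁; inj₂)
open import Data.Empty using (⊥; ⊥-elim)
open import Relation.Nullary using (¬_; yes; no; contradiction)
open import Relation.Binary using (tri<; tri≈; tri>)
open import Relation.Binary.PropositionalEquality hiding ([_])

module _ {A : Set} where

  applyUpTo-pointwise : ∀ (f g : ℕ → A) n {i} → applyUpTo f n ≡ applyUpTo g n → i < n → f i ≡ g i
  applyUpTo-pointwise f g (suc n) {zero}  eq _         = proj₁ (∷-injective eq)
  applyUpTo-pointwise f g (suc n) {suc i} eq (s<s i<n) =
    applyUpTo-pointwise (f ∘ suc) (g ∘ suc) n (proj₂ (∷-injective eq)) i<n

  applyDownFrom-applyUpTo : ∀ (f : ℕ → A) n → applyDownFrom f n ≡ applyUpTo (λ i → f (n ∸ suc i)) n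
  applyDownFrom-applyUpTo f zero    = refl
  applyDownFrom-applyUpTo f (suc n) = cong (f n ∷_) (applyDownFrom-applyUpTo f n)

  palindrome-mirror : ∀ (f : ℕ → A) n {i j} → reverse (applyUpTo f n) ≡ applyUpTo f n →
                      suc (i + j) ≡ n → f i ≡ f j
  palindrome-mirror f n {i} {j} palindrome 1+i+j≡n = begin
    f i            ≡⟨ cong f (sym n∸1+j≡i) ⟩
    f (n ∸ suc j)  ≡⟨ applyUpTo-pointwise (λ k → f (n ∸ suc k)) f n reflected j<n ⟩
    f j            ∎
    where
    open ≡-Reasoning
    reflected : applyUpTo (λ k → f (n ∸ suc k)) n ≡ applyUpTo f n
    reflected = trans (sym (applyDownFrom-applyUpTo f n)) (trans (sym (reverse-applyUpTo f n)) palindrome)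
    n∸1+j≡i : n ∸ suc j ≡ i
    n∸1+j≡i = trans (cong (_∸ suc j) (sym 1+i+j≡n)) (m+n∸n≡m i j)
    j<n : j < n
    j<n = subst (j <_) 1+i+j≡n (s≤s (m≤n+m j i))

  applyUpTo-≡-++-∷ : ∀ (f : ℕ → A) n xs {y ys} → applyUpTo f n ≡ xs ++ y ∷ ys →
                     length xs < n × f (length xs) ≡ y
  applyUpTo-≡-++-∷ f zero    []       ()
  applyUpTo-≡-++-∷ f zero    (_ ∷ _)  ()
  applyUpTo-≡-++-∷ f (suc n) []       eq = z<s , proj₁ (∷-injective eq)
  applyUpTo-≡-++-∷ f (suc n) (x ∷ xs) eq with applyUpTo-≡-++-∷ (f ∘ suc) n xs (proj₂ (∷-injective eq))
  ... | xs<n , fxs≡y = s<s xs<n , fxs≡y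

  palindrome-sandwich : ∀ {v w : List A} → reverse v ≡ v → reverse w ≡ w →
                        reverse (w ++ v ++ w) ≡ w ++ v ++ w
  palindrome-sandwich {v} {w} pv pw = begin
    reverse (w ++ v ++ w)                  ≡⟨ reverse-++ w (v ++ w) ⟩
    reverse (v ++ w) ++ reverse w          ≡⟨ cong (_++ reverse w) (reverse-++ v w) ⟩
    (reverse w ++ reverse v) ++ reverse w  ≡⟨ cong₂ (λ w′ v′ → (w′ ++ v′) ++ w′) pw pv ⟩
    (w ++ v) ++ w                          ≡⟨ ++-assoc w v w ⟩
    w ++ v ++ w                            ∎
    where open ≡-Reasoning

  unique-applyUpTo⁻ : ∀ {f : ℕ → A} n → Unique (applyUpTo f n) → ∀ {i j} → i < j → j < n → f i ≢ f j
  unique-applyUpTo⁻ (suc n) (f0≢ ∷ _)      {zero}  {suc j} _         (s<s j<n) = All.applyUpTo⁻ _ n f0≢ j<n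
  unique-applyUpTo⁻ (suc n) (_ ∷ distinct) {suc i} {suc j} (s<s i<j) (s<s j<n) =
    unique-applyUpTo⁻ n distinct i<j j<n

  applyUpTo-lookup : ∀ (xs : List A) {f : ℕ → A} →
                     (∀ i (i<n : i < length xs) → f i ≡ lookup xs (fromℕ< i<n)) → applyUpTo f (length xs) ≡ xs
  applyUpTo-lookup []       _  = refl
  applyUpTo-lookup (x ∷ xs) fi = cong₂ _∷_ (fi 0 z<s) (applyUpTo-lookup xs (λ i i<n → fi (suc i) (s<s i<n)))

-- Factors, letter counts and balance

module _ {k : ℕ} where

  factor-suc : ∀ (s : InfWord k) i n → factor s (suc i) n ≡ factor (s ∘ suc) i n
  factor-suc s i zero    = refl
  factor-suc s i (suc n) = cong (s (suc i) ∷_) (factor-suc s (suc i) n)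

  factor-applyUpTo : ∀ (s : InfWord k) n → factor s 0 n ≡ applyUpTo s n
  factor-applyUpTo s zero    = refl
  factor-applyUpTo s (suc n) = cong (s 0 ∷_) (trans (factor-suc s 0 n) (factor-applyUpTo (s ∘ suc) n))

  module _ (s : InfWord k) (e : Fin k) where

    occ-factor-tail : ∀ i n → occ e (factor s (suc i) n) ≤ occ e (factor s i (suc n))
    occ-factor-tail i n with e ≟ s i
    ... | yes _ = n≤1+n _
    ... | no  _ = ≤-refl

    occ-factor-head : ∀ i n → s i ≡ e → occ e (factor s i (suc n)) ≡ suc (occ e (factor s (suc i) n))
    occ-factor-head i n si≡e = cong length (filter-accept (e ≟_) (sym si≡e))

    occ-factor-pos : ∀ i n j → j < n → s (i + j) ≡ e → 1 ≤ occ e (factor s i n)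
    occ-factor-pos i (suc n) zero    _         eq =
      subst (1 ≤_) (sym (occ-factor-head i n (trans (cong s (sym (+-identityʳ i))) eq))) (s≤s z≤n)
    occ-factor-pos i (suc n) (suc j) (s<s j<n) eq =
      ≤-trans (occ-factor-pos (suc i) n j j<n (trans (cong s (sym (+-suc i j))) eq)) (occ-factor-tail i n)

    occ-factor-zero : ∀ i n → (∀ j → j < n → s (i + j) ≢ e) → occ e (factor s i n) ≡ 0
    occ-factor-zero i zero    _      = refl
    occ-factor-zero i (suc n) absent = trans
      (cong length (filter-reject (e ≟_) λ e≡si → absent 0 z<s (trans (cong s (+-identityʳ i)) (sym e≡si))))
      (occ-factor-zero (suc i) n λ j j<n → absent (suc j) (s<s j<n) ∘ trans (cong s (+-suc i j)))

balanced-no-gap : ∀ {k} {s : InfWord k} → Balanced s → ∀ {x i i′ m} → s i ≡ x → s (i + suc m) ≡ x →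
                  (∀ j → j < m → s (i′ + j) ≢ x) → s (i′ + m) ≢ x → s (i′ + suc m) ≢ x → ⊥
balanced-no-gap {s = s} balanced {x} {i} {i′} {m} si≡x si+1+m≡x gap i′+m≢x i′+1+m≢x = <⇒≱ two (begin
  count i                   ≡⟨ sym (∣-∣-identityʳ _) ⟩
  ∣ count i - 0 ∣            ≡⟨ cong (∣ count i -_∣) (sym none) ⟩
  ∣ count i - count i′ ∣     ≤⟨ balanced i i′ (2 + m) x ⟩
  1                         ∎)
  where
  open ≤-Reasoning
  count : ℕ → ℕ
  count j = occ x (factor s j (2 + m))
  two : 1 < count i
  two = subst (1 <_) (sym (occ-factor-head s x i (suc m) si≡x))
          (s≤s (occ-factor-pos s x (suc i) (suc m) m ≤-refl (trans (cong s (sym (+-suc i m))) si+1+m≡x)))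
  free : ∀ j → j < 2 + m → s (i′ + j) ≢ x
  free j j<2+m with m<1+n⇒m<n∨m≡n j<2+m
  ... | inj₂ refl = i′+1+m≢x
  ... | inj₁ j<1+m with m<1+n⇒m<n∨m≡n j<1+m
  ...   | inj₂ refl = i′+m≢x
  ...   | inj₁ j<m  = gap j j<m
  none : count i′ ≡ 0
  none = occ-factor-zero s x i′ (2 + m) free

avoid-two-letters : ∀ {k} {s : InfWord k} → AtLeastThreeLetters s → ∀ a b → ∃ λ i → s i ≢ a × s i ≢ b
avoid-two-letters {s = s} (i , j , l , i≢j , i≢l , j≢l) a b with s i ≟ a | s i ≟ b | s j ≟ a | s j ≟ b
... | no i≢a  | no i≢b  | _       | _       = i , i≢a , i≢b
... | _       | _       | no j≢a  | no j≢b  = j , j≢a , j≢b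
... | yes i≡a | _       | yes j≡a | _       = ⊥-elim (i≢j (trans i≡a (sym j≡a)))
... | _       | yes i≡b | _       | yes j≡b = ⊥-elim (i≢j (trans i≡b (sym j≡b)))
... | yes i≡a | _       | _       | yes j≡b =
  l , (λ l≡a → i≢l (trans i≡a (sym l≡a))) , (λ l≡b → j≢l (trans j≡b (sym l≡b)))
... | _       | yes i≡b | yes j≡a | _       =
  l , (λ l≡a → j≢l (trans j≡a (sym l≡a))) , (λ l≡b → i≢l (trans i≡b (sym l≡b)))

-- Fresh positions of a directive sequence

module _ {k : ℕ} (Δ : InfWord k) where

  Fresh : ℕ → Set
  Fresh n = ∀ q → q < n → Δ q ≢ Δ n

  fresh-or-recurs : ∀ n → Fresh n ⊎ ∃ λ q → q < n × Δ q ≡ Δ n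
  fresh-or-recurs n with anyUpTo? (λ q → Δ q ≟ Δ n) n
  ... | yes recurs = inj₂ recurs
  ... | no  fresh  = inj₁ λ q q<n Δq≡Δn → fresh (q , q<n , Δq≡Δn)

  first-occurrence : ∀ q → ∃ λ p → Fresh p × Δ p ≡ Δ q
  first-occurrence = <-rec _ step
    where
    step : ∀ q → (∀ {q′} → q′ < q → ∃ λ p → Fresh p × Δ p ≡ Δ q′) → ∃ λ p → Fresh p × Δ p ≡ Δ q
    step q earlier with fresh-or-recurs q
    ... | inj₁ fresh = q , fresh , refl
    ... | inj₂ (q′ , q′<q , Δq′≡Δq) with earlier q′<q
    ...   | p , fresh , Δp≡Δq′ = p , fresh , trans Δp≡Δq′ Δq′≡Δq

  fresh-bounded : ∀ o → ¬ (∀ i → i < suc k → Fresh (o + i))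
  fresh-bounded o fresh with pigeonhole (n<1+n k) (λ i → Δ (o + toℕ i))
  ... | i , j , i<j , eq = fresh (toℕ j) (toℕ<n j) (o + toℕ i) (+-monoʳ-< o i<j) eq

  fresh⇒unique : ∀ o n → (∀ i → i < n → Fresh (o + i)) → Unique (applyUpTo (λ i → Δ (o + i)) n)
  fresh⇒unique o n fresh = applyUpTo⁺₁ _ n λ i<j j<n → fresh _ j<n _ (+-monoʳ-< o i<j)

  unique⇒fresh : ∀ n → Unique (applyUpTo Δ n) → ∀ j → j < n → Fresh j
  unique⇒fresh n unique j j<n q q<j = unique-applyUpTo⁻ n unique q<j j<n

-- Palindromic prefixes

module _ {k : ℕ} {w p : List (Fin k)} {x : Fin k} where

  closure-length-≤ : IsPalClosure (w ++ [ x ]) p → IsPalindrome w → length p ≤ suc (length w + length w)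
  closure-length-≤ (_ , _ , shortest) palindrome =
    ≤-trans (shortest (w ++ x ∷ w) (palindrome-sandwich refl palindrome) (w , ++-assoc w [ x ] w))
            (≤-reflexive (trans (length-++ w) (+-suc (length w) (length w))))

  closure-length-≤-head : ∀ {t} → IsPalClosure (w ++ [ x ]) p → IsPalindrome w → w ≡ x ∷ t →
                          length p ≤ length w + length w
  closure-length-≤-head {t} (_ , _ , shortest) palindrome refl =
    ≤-trans (shortest (w ++ w) (palindrome-sandwich {v = []} refl palindrome) (t , ++-assoc w [ x ] t))
            (≤-reflexive (length-++ w))

module PalindromicPrefixes {k : ℕ} {s Δ : InfWord k} (u : ℕ → List (Fin k)) (u-zero : u 0 ≡ [])
  (closure : ∀ n → IsPalClosure (u n ++ [ Δ n ]) (u (suc n))) (prefix : ∀ n → IsPrefixOf (u n) s) where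

  len : ℕ → ℕ
  len n = length (u n)

  len-zero : len 0 ≡ 0
  len-zero = cong length u-zero

  u≡applyUpTo : ∀ n → u n ≡ applyUpTo s (len n)
  u≡applyUpTo n = trans (sym (prefix n)) (factor-applyUpTo s (len n))

  u-palindrome : ∀ n → IsPalindrome (u n)
  u-palindrome zero    rewrite u-zero = refl
  u-palindrome (suc n) = proj₁ (closure n)

  mirror : ∀ n {i j} → suc (i + j) ≡ len n → s i ≡ s j
  mirror n = palindrome-mirror s (len n) (subst IsPalindrome (u≡applyUpTo n) (u-palindrome n))

  u-extends : ∀ n → ∃ λ v → u (suc n) ≡ u n ++ Δ n ∷ v
  u-extends n with proj₁ (proj₂ (closure n))
  ... | v , extends = v , trans (sym extends) (++-assoc (u n) [ Δ n ] v)

  len-<-and-letter : ∀ n → len n < len (suc n) × s (len n) ≡ Δ n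
  len-<-and-letter n with u-extends n
  ... | v , extends = applyUpTo-≡-++-∷ s (len (suc n)) (u n) (trans (sym (u≡applyUpTo (suc n))) extends)

  len-< : ∀ n → len n < len (suc n)
  len-< n = proj₁ (len-<-and-letter n)

  s-at-len : ∀ n → s (len n) ≡ Δ n
  s-at-len n = proj₂ (len-<-and-letter n)

  s0≡Δ0 : s 0 ≡ Δ 0
  s0≡Δ0 = trans (cong s (sym len-zero)) (s-at-len 0)

  len-suc-≤ : ∀ n → len (suc n) ≤ suc (len n + len n)
  len-suc-≤ n = closure-length-≤ (closure n) (u-palindrome n)

  u-head : ∀ n → 0 < len n → ∃ λ t → u n ≡ s 0 ∷ t
  u-head n 0<len with m≤n⇒∃[o]m+o≡n 0<len
  ... | j , 1+j≡len = applyUpTo (s ∘ suc) j , trans (u≡applyUpTo n) (cong (applyUpTo s) (sym 1+j≡len))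

  len-suc-≤-head : ∀ n → 0 < len n → s 0 ≡ Δ n → len (suc n) ≤ len n + len n
  len-suc-≤-head n 0<len s0≡Δn with u-head n 0<len
  ... | t , un≡ = closure-length-≤-head (closure n) (u-palindrome n) (trans un≡ (cong (_∷ t) s0≡Δn))

  len-mono : ∀ {m n} → m < n → len m < len n
  len-mono {m} {suc n} m<1+n with m<1+n⇒m<n∨m≡n m<1+n
  ... | inj₁ m<n  = <-trans (len-mono m<n) (len-< n)
  ... | inj₂ refl = len-< n

  n≤len : ∀ n → n ≤ len n
  n≤len zero    = z≤n
  n≤len (suc n) = ≤-<-trans (n≤len n) (len-< n)

  suffix-copy : ∀ {m n c} → c + len m ≡ len n → ∀ {i} → i < len m → s (c + i) ≡ s i
  suffix-copy {m} {n} {c} c+len≡len {i} i<len with m≤n⇒∃[o]m+o≡n i<len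
  ... | j , 1+i+j≡len = trans (mirror n (begin
    suc (c + i + j)    ≡⟨ cong suc (+-assoc c i j) ⟩
    suc (c + (i + j))  ≡⟨ sym (+-suc c (i + j)) ⟩
    c + suc (i + j)    ≡⟨ cong (c +_) 1+i+j≡len ⟩
    c + len m          ≡⟨ c+len≡len ⟩
    len n              ∎)) (sym (mirror m 1+i+j≡len))
    where open ≡-Reasoning

  closure-suffix : ∀ n → ∃ λ p → suc (p + len n) ≡ len (suc n) × s p ≡ Δ n
  closure-suffix n with m≤n⇒∃[o]m+o≡n (len-< n)
  ... | p , 1+len+p≡len = p , 1+p+len≡len , trans (mirror (suc n) 1+p+len≡len) (s-at-len n)
    where
    1+p+len≡len : suc (p + len n) ≡ len (suc n)
    1+p+len≡len = trans (cong suc (+-comm p (len n))) 1+len+p≡len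

  letter-absent : ∀ n {x} → (∀ q → q < n → Δ q ≢ x) → ∀ i → i < len n → s i ≢ x
  letter-absent zero    _      i i<len = contradiction (subst (i <_) len-zero i<len) λ ()
  letter-absent (suc n) absent i i<len with <-cmp i (len n)
  ... | tri< i<len′ _ _ = letter-absent n (λ q q<n → absent q (m<n⇒m<1+n q<n)) i i<len′
  ... | tri≈ _ refl _   = λ si≡x → absent n ≤-refl (trans (sym (s-at-len n)) si≡x)
  ... | tri> _ _ len<i with m≤n⇒∃[o]m+o≡n i<len
  ...   | j , 1+i+j≡len = λ si≡x → letter-absent n (λ q q<n → absent q (m<n⇒m<1+n q<n)) j j<len
                            (trans (sym (mirror (suc n) 1+i+j≡len)) si≡x)
    where
    j<len : j < len n
    j<len = +-cancelˡ-< (len n) j (len n)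
      (<-≤-trans (+-monoˡ-< j len<i) (≤-pred (≤-trans (≤-reflexive 1+i+j≡len) (len-suc-≤ n))))

  fresh⇒len-suc : ∀ {n} → Fresh Δ n → len (suc n) ≡ suc (len n + len n)
  fresh⇒len-suc {n} fresh with closure-suffix n
  ... | p , 1+p+len≡len , sp≡Δn = trans (sym 1+p+len≡len) (cong (λ p → suc (p + len n)) p≡len)
    where
    p≡len : p ≡ len n
    p≡len = ≤-antisym
      (+-cancelʳ-≤ (len n) p (len n) (≤-pred (≤-trans (≤-reflexive 1+p+len≡len) (len-suc-≤ n))))
      (≮⇒≥ λ p<len → letter-absent n fresh p p<len sp≡Δn)

  fresh⇒copy : ∀ {n} → Fresh Δ n → ∀ {i} → i < len n → s (suc (len n + i)) ≡ s i
  fresh⇒copy fresh = suffix-copy (sym (fresh⇒len-suc fresh))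

  letter-fresh-occurrence : ∀ i → ∃ λ p → Fresh Δ p × Δ p ≡ s i
  letter-fresh-occurrence i with anyUpTo? (λ q → Δ q ≟ s i) (suc i)
  ... | no  absent = ⊥-elim
    (letter-absent (suc i) (λ q q<1+i Δq≡si → absent (q , q<1+i , Δq≡si)) i (n≤len (suc i)) refl)
  ... | yes (q , _ , Δq≡si) with first-occurrence Δ q
  ...   | p , fresh , Δp≡Δq = p , fresh , trans Δp≡Δq Δq≡si

  fresh-beyond-one : AtLeastThreeLetters s → ∃ λ p → 1 < p × Fresh Δ p
  fresh-beyond-one three with avoid-two-letters three (Δ 0) (Δ 1)
  ... | i , si≢Δ0 , si≢Δ1 with letter-fresh-occurrence i
  ...   | zero        , _     , Δ0≡si = ⊥-elim (si≢Δ0 (sym Δ0≡si))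
  ...   | suc zero    , _     , Δ1≡si = ⊥-elim (si≢Δ1 (sym Δ1≡si))
  ...   | suc (suc p) , fresh , _     = suc (suc p) , s<s z<s , fresh

  HeadSquareFree : ℕ → Set
  HeadSquareFree n = ∀ i → suc i < len n → s i ≡ s 0 → s (suc i) ≢ s 0

  head-square-free : ∀ m → (∀ j → j < m → Fresh Δ (suc j)) → HeadSquareFree (suc m)
  head-square-free zero _ i 1+i<len _ _ = contradiction
    (subst (suc i <_) (trans (fresh⇒len-suc (λ _ ())) (cong (λ l → suc (l + l)) len-zero)) 1+i<len)
    λ { (s≤s ()) }
  head-square-free (suc m) fresh = square-free
    where
    L′ = len (suc m)
    copy : ∀ {i} → i < L′ → s (suc (L′ + i)) ≡ s i
    copy = fresh⇒copy (fresh m ≤-refl)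
    new≢s0 : s L′ ≢ s 0
    new≢s0 new≡s0 = fresh m ≤-refl 0 z<s (trans (sym s0≡Δ0) (trans (sym new≡s0) (s-at-len (suc m))))
    square-free-u : HeadSquareFree (suc m)
    square-free-u = head-square-free m (λ j j<m → fresh j (m<n⇒m<1+n j<m))
    square-free : HeadSquareFree (suc (suc m))
    square-free i 1+i<len si≡s0 s1+i≡s0 with <-cmp (suc i) L′
    ... | tri< 1+i<L′ _ _ = square-free-u i 1+i<L′ si≡s0 s1+i≡s0
    ... | tri≈ _ 1+i≡L′ _ = new≢s0 (trans (cong s (sym 1+i≡L′)) s1+i≡s0)
    ... | tri> _ _ L′<1+i with m≤n⇒m<n∨m≡n (≤-pred L′<1+i)
    ...   | inj₂ refl   = new≢s0 si≡s0
    ...   | inj₁ L′<i with m≤n⇒∃[o]m+o≡n L′<i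
    ...     | i′ , refl = square-free-u i′ 1+i′<L′ (trans (sym (copy i′<L′)) si≡s0)
                            (trans (sym (copy 1+i′<L′)) (trans (cong (s ∘ suc) (+-suc L′ i′)) s1+i≡s0))
      where
      1+i′<L′ : suc i′ < L′
      1+i′<L′ = +-cancelˡ-< L′ (suc i′) L′ (≤-pred (begin
        suc (suc (L′ + suc i′))    ≡⟨ cong (suc ∘ suc) (+-suc L′ i′) ⟩
        suc (suc (suc (L′ + i′)))  ≤⟨ 1+i<len ⟩
        len (suc (suc m))          ≡⟨ fresh⇒len-suc (fresh m ≤-refl) ⟩
        suc (L′ + L′)              ∎))
        where open ≤-Reasoning
      i′<L′ : i′ < L′
      i′<L′ = <-trans (n<1+n i′) 1+i′<L′

  len-doubles : ∀ {n} → 0 < len n → Δ n ≡ s 0 → HeadSquareFree n → len (suc n) ≡ len n + len n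
  len-doubles {n} 0<len Δn≡s0 square-free with closure-suffix n
  ... | p , 1+p+len≡len , sp≡Δn = trans (sym 1+p+len≡len) (cong (_+ len n) 1+p≡len)
    where
    s1+p≡s0 : s (suc p) ≡ s 0
    s1+p≡s0 = trans (cong (s ∘ suc) (sym (+-identityʳ p))) (suffix-copy 1+p+len≡len 0<len)
    1+p≡len : suc p ≡ len n
    1+p≡len with m≤n⇒m<n∨m≡n (+-cancelʳ-≤ (len n) (suc p) (len n)
                  (≤-trans (≤-reflexive 1+p+len≡len) (len-suc-≤-head n 0<len (sym Δn≡s0))))
    ... | inj₁ 1+p<len = ⊥-elim (square-free p 1+p<len (trans sp≡Δn Δn≡s0) s1+p≡s0)
    ... | inj₂ 1+p≡len = 1+p≡len

  -- Balanced words

  module _ (balanced : Balanced s) where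

    recurrence-window : ∀ {n n′} → n < n′ → Δ n′ ≡ Δ n → ∃ λ i → s i ≡ Δ n × s (i + suc (len n)) ≡ Δ n
    recurrence-window {n} {n′} n<n′ Δn′≡Δn with closure-suffix n′
    ... | p , 1+p+len≡len , sp≡Δn′ = p , trans sp≡Δn′ Δn′≡Δn ,
      trans (cong s (+-suc p (len n))) (trans (suffix-copy 1+p+len≡len (len-mono n<n′)) (s-at-len n))

    fresh-blocks-recurrence : ∀ {n p n′} → 0 < n → Fresh Δ n → n < p → Fresh Δ p → n < n′ → Δ n′ ≢ Δ n
    fresh-blocks-recurrence {n} {p} 0<n fresh-n n<p fresh-p n<n′ Δn′≡Δn
      with recurrence-window n<n′ Δn′≡Δn | m≤n⇒∃[o]m+o≡n (<⇒≤ (len-mono n<p))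
    ... | _ , si≡Δn , sj≡Δn | d , len+d≡len = balanced-no-gap balanced si≡Δn sj≡Δn
      (λ j j<len → absent j j<len ∘ trans (sym (suffix-copy d+len≡len j<len)))
      (λ sd+len≡Δn → fresh-p n n<p (trans (sym sd+len≡Δn) (trans (cong s d+len≡len) (s-at-len p))))
      (λ sd+1+len≡Δn → absent 0 0<len (trans (sym s-after) sd+1+len≡Δn))
      where
      absent : ∀ j → j < len n → s j ≢ Δ n
      absent = letter-absent n fresh-n
      0<len : 0 < len n
      0<len = <-≤-trans 0<n (n≤len n)
      d+len≡len : d + len n ≡ len p
      d+len≡len = trans (+-comm d (len n)) len+d≡len
      s-after : s (d + suc (len n)) ≡ s 0
      s-after = trans (cong s (trans (+-suc d (len n)) (cong suc (trans d+len≡len (sym (+-identityʳ (len p)))))))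
                      (fresh⇒copy fresh-p (<-trans 0<len (len-mono n<p)))

    -- The Δ n-free factor starts right after Δ n in u (n+1) = u n Δ n u n: it is u n, then a, then
    -- s 1, read off u (n+2) = u (n+1) u (n+1).
    last-fresh-never-recurs : ∀ n → 1 < n → (∀ j → j < n → Fresh Δ (suc j)) → Δ (suc n) ≡ Δ 0 →
                              ∀ {n′} → n < n′ → Δ n′ ≢ Δ n
    last-fresh-never-recurs (suc n) 1<n fresh Δ≡Δ0 n<n′ Δn′≡Δn with recurrence-window n<n′ Δn′≡Δn
    ... | _ , si≡Δn , sj≡Δn = balanced-no-gap balanced si≡Δn sj≡Δn
      (λ j j<L → absent j j<L ∘ trans (sym (fresh⇒copy fresh-n j<L)))
      (λ sL′≡Δn → absent 0 0<L (trans (sym sL′≡s0) sL′≡Δn))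
      (λ s1+L′≡Δn → absent 1 1<L (trans (sym s1+L′≡s1) s1+L′≡Δn))
      where
      L  = len (suc n)
      L′ = len (suc (suc n))
      fresh-n : Fresh Δ (suc n)
      fresh-n = fresh n ≤-refl
      absent : ∀ j → j < L → s j ≢ Δ (suc n)
      absent = letter-absent (suc n) fresh-n
      0<L : 0 < L
      0<L = <-≤-trans z<s (n≤len (suc n))
      1<L : 1 < L
      1<L = <-≤-trans 1<n (n≤len (suc n))
      L′≡ : L′ ≡ suc (L + L)
      L′≡ = fresh⇒len-suc fresh-n
      Δ≡s0 : Δ (suc (suc n)) ≡ s 0
      Δ≡s0 = trans Δ≡Δ0 (sym s0≡Δ0)
      sL′≡s0 : s (suc (L + L)) ≡ s 0
      sL′≡s0 = trans (cong s (sym L′≡)) (trans (s-at-len (suc (suc n))) Δ≡s0)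
      s1+L′≡s1 : s (suc (L + suc L)) ≡ s 1
      s1+L′≡s1 = trans (cong s (trans (cong suc (trans (+-suc L L) (sym L′≡))) (+-comm 1 L′)))
        (suffix-copy (sym (len-doubles (<-≤-trans z<s (len-< (suc n))) Δ≡s0 (head-square-free (suc n) fresh)))
                     (<-trans 1<L (len-< (suc n))))

    module Directive-a-y-a-z (three : AtLeastThreeLetters s) (m : ℕ) (y-fresh : ∀ j → j < m → Fresh Δ (suc j))
      (Δ-a : Δ (suc m) ≡ Δ 0) (z≢a : ∀ t → Δ (2 + m + t) ≢ Δ 0) where

      z : ℕ → Fin k
      z t = Δ (2 + m + t)

      FreshUpTo : ℕ → Set
      FreshUpTo r = ∀ i → i < r → Fresh Δ (2 + m + i)

      before-z : ∀ {q} t → q < 2 + m → q < 2 + m + t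
      before-z t q<2+m = <-≤-trans q<2+m (m≤m+n (2 + m) t)

      y-never-recurs : ∀ j → j < m → ∀ t → z t ≢ Δ (suc j)
      y-never-recurs zero 0<m t with fresh-beyond-one three
      ... | p , 1<p , fresh-p =
        fresh-blocks-recurrence z<s (y-fresh 0 0<m) 1<p fresh-p (before-z t (s<s (s<s z≤n)))
      y-never-recurs (suc j) 1+j<m t with m≤n⇒m<n∨m≡n 1+j<m
      ... | inj₁ 2+j<m = fresh-blocks-recurrence z<s (y-fresh (suc j) 1+j<m) ≤-refl (y-fresh (suc (suc j)) 2+j<m)
                           (before-z t (s<s (m<n⇒m<1+n 1+j<m)))
      ... | inj₂ 2+j≡m = last-fresh-never-recurs (suc (suc j)) (s<s (s<s z≤n))
                           (λ i i<2+j → y-fresh i (<-≤-trans i<2+j (≤-reflexive 2+j≡m)))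
                           (subst (λ n → Δ (suc n) ≡ Δ 0) (sym 2+j≡m) Δ-a) (before-z t (s<s (m<n⇒m<1+n 1+j<m)))

      z-avoids-aya : ∀ q → q < 2 + m → ∀ t → z t ≢ Δ q
      z-avoids-aya zero    _       t = z≢a t
      z-avoids-aya (suc q) 1+q<2+m t with m<1+n⇒m<n∨m≡n (≤-pred 1+q<2+m)
      ... | inj₁ q<m  = y-never-recurs q q<m t
      ... | inj₂ refl = λ zt≡Δ1+m → z≢a t (trans zt≡Δ1+m Δ-a)

      z-fresh-or-repeats : ∀ i → Fresh Δ (2 + m + i) ⊎ ∃ λ i′ → i′ < i × z i′ ≡ z i
      z-fresh-or-repeats i with fresh-or-recurs Δ (2 + m + i)
      ... | inj₁ fresh = inj₁ fresh
      ... | inj₂ (q , q<2+m+i , Δq≡zi) with <-≤-connex q (2 + m)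
      ...   | inj₁ q<2+m = ⊥-elim (z-avoids-aya q q<2+m i (sym Δq≡zi))
      ...   | inj₂ 2+m≤q with m≤n⇒∃[o]m+o≡n 2+m≤q
      ...     | i′ , refl = inj₂ (i′ , +-cancelˡ-< (2 + m) i′ i q<2+m+i , Δq≡zi)

      z-fresh-pair-never-recurs : ∀ {i i′} → Fresh Δ (2 + m + i) → Fresh Δ (2 + m + suc i) → i < i′ →
                                  z i′ ≢ z i
      z-fresh-pair-never-recurs {i} fresh fresh′ i<i′ =
        fresh-blocks-recurrence z<s fresh (+-monoʳ-< (2 + m) (n<1+n i)) fresh′ (+-monoʳ-< (2 + m) i<i′)

      fresh-prefix-or-repeat : ∀ t → FreshUpTo t ⊎ ∃ λ r → FreshUpTo (suc r) × z (suc r) ≡ z r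
      fresh-prefix-or-repeat zero = inj₁ λ _ ()
      fresh-prefix-or-repeat (suc t) with fresh-prefix-or-repeat t
      ... | inj₂ repeat = inj₂ repeat
      ... | inj₁ fresh with z-fresh-or-repeats t
      ...   | inj₁ fresh-t = inj₁ extended
        where
        extended : FreshUpTo (suc t)
        extended i i<1+t with m<1+n⇒m<n∨m≡n i<1+t
        ... | inj₁ i<t  = fresh i i<t
        ... | inj₂ refl = fresh-t
      ...   | inj₂ (i , i<t , zi≡zt) with m≤n⇒m<n∨m≡n i<t
      ...     | inj₁ 1+i<t = ⊥-elim
        (z-fresh-pair-never-recurs (fresh i i<t) (fresh (suc i) 1+i<t) i<t (sym zi≡zt))
      ...     | inj₂ refl  = inj₂ (i , fresh , sym zi≡zt)

      z-first-repeat : ∃ λ r → FreshUpTo (suc r) × z (suc r) ≡ z r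
      z-first-repeat with fresh-prefix-or-repeat (suc k)
      ... | inj₁ fresh  = ⊥-elim (fresh-bounded Δ (2 + m) fresh)
      ... | inj₂ repeat = repeat

      z-constant-tail : ∀ {r} → FreshUpTo (suc r) → z (suc r) ≡ z r → ∀ j → z (r + j) ≡ z r
      z-constant-tail {r} fresh repeat = <-rec _ step
        where
        step : ∀ j → (∀ {j′} → j′ < j → z (r + j′) ≡ z r) → z (r + j) ≡ z r
        step zero    _       = cong z (+-identityʳ r)
        step (suc j) earlier with z-fresh-or-repeats (r + suc j)
        ... | inj₁ fresh-j = ⊥-elim (fresh-blocks-recurrence z<s (fresh r ≤-refl)
                               (+-monoʳ-< (2 + m) (m<m+n r z<s)) fresh-j (+-monoʳ-< (2 + m) (n<1+n r)) repeat)
        ... | inj₂ (i , i<r+1+j , zi≡z) with <-≤-connex i r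
        ...   | inj₁ i<r = ⊥-elim (z-fresh-pair-never-recurs (fresh i (m<n⇒m<1+n i<r)) (fresh (suc i) (s<s i<r))
                             i<r+1+j (sym zi≡z))
        ...   | inj₂ r≤i with m≤n⇒∃[o]m+o≡n r≤i
        ...     | j′ , refl = trans (sym zi≡z) (earlier (+-cancelˡ-< r j′ (suc j) i<r+1+j))

      directive-shape : ∃ λ r → Unique (applyUpTo Δ (suc m) ++ applyUpTo z (suc r)) × (∀ j → z (r + j) ≡ z r)
      directive-shape with z-first-repeat
      ... | r , fresh , repeat =
        r , ++⁺ unique-aya (fresh⇒unique Δ (2 + m) (suc r) fresh) disjoint , z-constant-tail fresh repeat
        where
        unique-aya : Unique (applyUpTo Δ (suc m))
        unique-aya = fresh⇒unique Δ 0 (suc m) λ where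
          zero    _         _ ()
          (suc j) (s<s j<m) → y-fresh j j<m
        disjoint : ∀ {v} → ¬ (v ∈ applyUpTo Δ (suc m) × v ∈ applyUpTo z (suc r))
        disjoint (v∈aya , v∈z) with ∈-applyUpTo⁻ Δ v∈aya | ∈-applyUpTo⁻ z v∈z
        ... | q , q<1+m , v≡Δq | t , _ , v≡zt = z-avoids-aya q (m<n⇒m<1+n q<1+m) t (trans (sym v≡zt) v≡Δq)

proposition3p11 : (k : ℕ) (s Δ : InfWord k) → Balanced s → AtLeastThreeLetters s →
    IsDirective Δ s → (a : Fin k) (y : List (Fin k)) → 1 ≤ length y → Unique y →
    ¬ (a ∈ y) → Δ 0 ≡ a → (∀ (i : ℕ) (h : i < length y) → Δ (suc i) ≡ lookup y (fromℕ< h)) →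
    Δ (suc (length y)) ≡ a → (∀ j → Δ (2 + length y + j) ≢ a) →
    Σ (List (Fin k)) λ bs → Σ (Fin k) λ c →
    Unique (a ∷ y ++ bs ++ [ c ]) ×
    (∀ (i : ℕ) (h : i < length bs) → Δ (2 + length y + i) ≡ lookup bs (fromℕ< h)) ×
    (∀ j → Δ (2 + length y + length bs + j) ≡ c)
-- The argument never uses that y is nonempty.
proposition3p11 k s Δ balanced three (u , u-zero , closure , prefix) a y _ unique-y a∉y refl Δ-y Δ-a z≢a =
  applyUpTo z r , z r , unique , Δ-at-bs , Δ-at-c
  where
  y≡ : applyUpTo (Δ ∘ suc) (length y) ≡ y
  y≡ = applyUpTo-lookup y Δ-y
  y-fresh : ∀ j → j < length y → Fresh Δ (suc j)
  y-fresh j j<m = unique⇒fresh Δ (suc (length y))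
    (subst (λ w → Unique (Δ 0 ∷ w)) (sym y≡) (¬Any⇒All¬ y a∉y ∷ unique-y)) (suc j) (s<s j<m)
  open PalindromicPrefixes u u-zero closure prefix
  open Directive-a-y-a-z balanced three (length y) y-fresh Δ-a z≢a
  r : ℕ
  r = proj₁ directive-shape
  unique : Unique (Δ 0 ∷ y ++ applyUpTo z r ++ [ z r ])
  unique = subst₂ (λ w t → Unique (Δ 0 ∷ w ++ t)) y≡ (sym (applyUpTo-∷ʳ z r)) (proj₁ (proj₂ directive-shape))
  Δ-at-bs : ∀ i (h : i < length (applyUpTo z r)) → z i ≡ lookup (applyUpTo z r) (fromℕ< h)
  Δ-at-bs i h = sym (trans (lookup-applyUpTo z r (fromℕ< h)) (cong z (toℕ-fromℕ< h)))
  Δ-at-c : ∀ j → Δ (2 + length y + length (applyUpTo z r) + j) ≡ z r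
  Δ-at-c j rewrite length-applyUpTo z r = trans (cong Δ (+-assoc (2 + length y) r j)) (proj₂ (proj₂ directive-shape) j)
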